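{- For any integer $k\geq 1$ and integers $n_1>n_2>\dots>n_k\geq 0$ we have \[ |\alpha^{ -n_1}+\dots+\alpha^{ -n_k}|<3 \qquad\text{and}\qquad |\beta^{n_1}+\dots+\beta^{n_k}|<3, \] where $\alpha=\frac{1+\sqrt5}{2}$ and $\beta=\frac{1-\sqrt5}{2}$. -}

module Defs where

open import Data.Nat using (ℕ; zero; suc)
open import Data.Integer using (ℤ; +_; -_; _+_; _*_; _≤_; _<_)
open import Data.Product using (_×_)
open import Data.Sum using (_⊎_)
open import Data.List using (List; []; _∷_)

-- The ring ℤ[φ], φ = (1+√5)/2 (golden ratio), φ² = φ + 1.
-- An element  mk a b  denotes the real number  a + b·φ.
record ℤφ : Set where
  constructor mk
  field
    re : ℤ
    im : ℤ
open ℤφ public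

0φ : ℤφ
0φ = mk (+ 0) (+ 0)

1φ : ℤφ
1φ = mk (+ 1) (+ 0)

_+φ_ : ℤφ → ℤφ → ℤφ
mk a b +φ mk c d = mk (a + c) (b + d)

-- (a + bφ)(c + dφ) = ac + bd + (ad + bc + bd)φ
_*φ_ : ℤφ → ℤφ → ℤφ
mk a b *φ mk c d = mk (a * c + b * d) (a * d + b * c + b * d)

_^φ_ : ℤφ → ℕ → ℤφ
x ^φ zero = 1φ
x ^φ suc n = x *φ (x ^φ n)

-- α = φ, and α⁻¹ = φ - 1
α⁻¹ : ℤφ
α⁻¹ = mk (- + 1) (+ 1)

-- β = (1 - √5)/2 = 1 - φ
β : ℤφ
β = mk (+ 1) (- + 1)

-- Real order via the embedding φ ↦ (1+√5)/2.
-- Sqrt5Lt u v  means  u·√5 < v  (as real numbers), for integers u, v.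
Sqrt5Lt : ℤ → ℤ → Set
Sqrt5Lt u v =
  (u ≤ + 0 × (+ 0 < v ⊎ v * v < + 5 * (u * u)))
  ⊎ (+ 0 ≤ u × + 0 < v × + 5 * (u * u) < v * v)

-- |a + bφ| < 3  as a real number.  Since a + bφ = (2a + b + b√5)/2 this is
--   b√5 < 6 - (2a + b)   and   (-b)√5 < 6 + (2a + b).
AbsLt3 : ℤφ → Set
AbsLt3 (mk a b) =
  Sqrt5Lt b (+ 6 + (- (+ 2 * a + b))) × Sqrt5Lt (- b) (+ 6 + (+ 2 * a + b))

sumPows : ℤφ → List ℕ → ℤφ
sumPows x [] = 0φ
sumPows x (n ∷ ns) = (x ^φ n) +φ sumPows x ns

module Submission where

-- Since α⁻¹ = φ − 1 = −β > 0, we have |α⁻ⁿ| = |βⁿ| = α⁻ⁿ, so both sums are bounded in absolute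
-- value by 1 + α⁻¹ + … + α^(−n₁) = φ²(1 − α^(−n₁−1)) < φ² = 3 − α⁻².  Everything is done inside
-- ℤ[φ]: x ≤ y means that y − x is a sum of elements α⁻ᵏ(a + bφ) with a, b ≥ 0, and positivity is
-- transported to the reals with the trace and norm of x = a + bφ and its conjugate x̄ = a + b(1 − φ).

open import Defs
open import Data.Nat using (ℕ; zero; suc; _>_; _≤′_; ≤′-reflexive; ≤′-step; z≤n; s≤s)
open import Data.Nat.Properties using (≤⇒≤′; n<1+n)
open import Data.Integer using (ℤ; +_; -[1+_]; -_; _+_; _*_; _-_; _≤_; _<_; +≤+; +<+; +0; 0ℤ)
import Data.Integer.Properties as ℤ
open import Data.Integer.Tactic.RingSolver renaming (solve-∀ to solve-∀-ℤ)
open import Data.List using (List; []; _∷_)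
open import Data.List.Relation.Unary.Linked using (Linked; [-]; _∷_)
open import Data.Product using (_×_; _,_)
open import Data.Sum using (_⊎_; inj₁; inj₂; [_,_]′; map)
open import Data.Empty using (⊥-elim)
open import Data.Maybe using (just; nothing)
open import Level using (0ℓ)
open import Relation.Nullary using (yes; no; contradiction)
open import Relation.Binary.PropositionalEquality
open import Algebra.Bundles using (CommutativeRing)
open import Algebra.Definitions (_≡_ {A = ℤφ})
open import Tactic.RingSolver using (solve-∀)
open import Tactic.RingSolver.Core.AlmostCommutativeRing using (AlmostCommutativeRing; fromCommutativeRing)

infix  8 -φ_
infixl 6 _-φ_
infix  4 _≤φ_ ∣_∣≤_

-φ_ : ℤφ → ℤφ
-φ mk a b = mk (- a) (- b)

_-φ_ : ℤφ → ℤφ → ℤφ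
x -φ y = x +φ (-φ y)

φ : ℤφ
φ = mk (+ 0) (+ 1)

φ² : ℤφ
φ² = mk (+ 1) (+ 1)

three : ℤφ
three = mk (+ 3) (+ 0)

+φ-assoc : Associative _+φ_
+φ-assoc (mk a b) (mk c d) (mk e f) = cong₂ mk (ℤ.+-assoc a c e) (ℤ.+-assoc b d f)

+φ-comm : Commutative _+φ_
+φ-comm (mk a b) (mk c d) = cong₂ mk (ℤ.+-comm a c) (ℤ.+-comm b d)

+φ-identityˡ : LeftIdentity 0φ _+φ_
+φ-identityˡ (mk a b) = cong₂ mk (ℤ.+-identityˡ a) (ℤ.+-identityˡ b)

+φ-identityʳ : RightIdentity 0φ _+φ_
+φ-identityʳ (mk a b) = cong₂ mk (ℤ.+-identityʳ a) (ℤ.+-identityʳ b)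

-φ-inverseˡ : LeftInverse 0φ -φ_ _+φ_
-φ-inverseˡ (mk a b) = cong₂ mk (ℤ.+-inverseˡ a) (ℤ.+-inverseˡ b)

-φ-inverseʳ : RightInverse 0φ -φ_ _+φ_
-φ-inverseʳ (mk a b) = cong₂ mk (ℤ.+-inverseʳ a) (ℤ.+-inverseʳ b)

*φ-comm : Commutative _*φ_
*φ-comm (mk a b) (mk c d) = cong₂ mk (re-comm a b c d) (im-comm a b c d)
  where
  re-comm : ∀ a b c d → a * c + b * d ≡ c * a + d * b
  re-comm = solve-∀-ℤ
  im-comm : ∀ a b c d → a * d + b * c + b * d ≡ c * b + d * a + d * b
  im-comm = solve-∀-ℤ

*φ-assoc : Associative _*φ_
*φ-assoc (mk a b) (mk c d) (mk e f) = cong₂ mk (re-assoc a b c d e f) (im-assoc a b c d e f)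
  where
  re-assoc : ∀ a b c d e f →
    (a * c + b * d) * e + (a * d + b * c + b * d) * f
      ≡ a * (c * e + d * f) + b * (c * f + d * e + d * f)
  re-assoc = solve-∀-ℤ
  im-assoc : ∀ a b c d e f →
    (a * c + b * d) * f + (a * d + b * c + b * d) * e + (a * d + b * c + b * d) * f
      ≡ a * (c * f + d * e + d * f) + b * (c * e + d * f) + b * (c * f + d * e + d * f)
  im-assoc = solve-∀-ℤ

*φ-identityˡ : LeftIdentity 1φ _*φ_
*φ-identityˡ (mk a b) = cong₂ mk (re-identity a b) (im-identity a b)
  where
  re-identity : ∀ a b → + 1 * a + + 0 * b ≡ a
  re-identity = solve-∀-ℤ
  im-identity : ∀ a b → + 1 * b + + 0 * a + + 0 * b ≡ b
  im-identity = solve-∀-ℤ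

*φ-identityʳ : RightIdentity 1φ _*φ_
*φ-identityʳ x = trans (*φ-comm x 1φ) (*φ-identityˡ x)

*φ-distribˡ-+φ : _*φ_ DistributesOverˡ _+φ_
*φ-distribˡ-+φ (mk a b) (mk c d) (mk e f) =
  cong₂ mk (re-distrib a b c d e f) (im-distrib a b c d e f)
  where
  re-distrib : ∀ a b c d e f → a * (c + e) + b * (d + f) ≡ (a * c + b * d) + (a * e + b * f)
  re-distrib = solve-∀-ℤ
  im-distrib : ∀ a b c d e f →
    a * (d + f) + b * (c + e) + b * (d + f) ≡ (a * d + b * c + b * d) + (a * f + b * e + b * f)
  im-distrib = solve-∀-ℤ

*φ-distribʳ-+φ : _*φ_ DistributesOverʳ _+φ_
*φ-distribʳ-+φ x y z = begin
  (y +φ z) *φ x           ≡⟨ *φ-comm (y +φ z) x ⟩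
  x *φ (y +φ z)           ≡⟨ *φ-distribˡ-+φ x y z ⟩
  (x *φ y) +φ (x *φ z)    ≡⟨ cong₂ _+φ_ (*φ-comm x y) (*φ-comm x z) ⟩
  (y *φ x) +φ (z *φ x)    ∎
  where open ≡-Reasoning

ℤφ-commutativeRing : CommutativeRing 0ℓ 0ℓ
ℤφ-commutativeRing = record
  { Carrier = ℤφ ; _≈_ = _≡_ ; _+_ = _+φ_ ; _*_ = _*φ_ ; -_ = -φ_ ; 0# = 0φ ; 1# = 1φ
  ; isCommutativeRing = record
    { isRing = record
      { +-isAbelianGroup = record
        { isGroup = record
          { isMonoid = record
            { isSemigroup = record
              { isMagma = record { isEquivalence = isEquivalence ; ∙-cong = cong₂ _+φ_ }
              ; assoc = +φ-assoc }
            ; identity = +φ-identityˡ , +φ-identityʳ }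
          ; inverse = -φ-inverseˡ , -φ-inverseʳ
          ; ⁻¹-cong = cong (λ x → -φ x) }
        ; comm = +φ-comm }
      ; *-cong = cong₂ _*φ_
      ; *-assoc = *φ-assoc
      ; *-identity = *φ-identityˡ , *φ-identityʳ
      ; distrib = *φ-distribˡ-+φ , *φ-distribʳ-+φ }
    ; *-comm = *φ-comm } }

-- Constants such as φ and α⁻¹ are closed terms, so the solver computes with them and knows φα⁻¹ = 1.
ℤφ-ring : AlmostCommutativeRing 0ℓ 0ℓ
ℤφ-ring = fromCommutativeRing ℤφ-commutativeRing λ { (mk +0 +0) → just refl ; _ → nothing }

α⁻¹*φ-mk : ∀ a b → α⁻¹ *φ mk a b ≡ mk (b - a) a
α⁻¹*φ-mk a b = cong₂ mk (re-eq a b) (im-eq a b)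
  where
  re-eq : ∀ a b → - + 1 * a + + 1 * b ≡ b - a
  re-eq = solve-∀-ℤ
  im-eq : ∀ a b → - + 1 * b + + 1 * a + + 1 * b ≡ a
  im-eq = solve-∀-ℤ

φ*φ-mk : ∀ a b → φ *φ mk a b ≡ mk b (a + b)
φ*φ-mk a b = cong₂ mk (re-eq a b) (im-eq a b)
  where
  re-eq : ∀ a b → + 0 * a + + 1 * b ≡ b
  re-eq = solve-∀-ℤ
  im-eq : ∀ a b → + 0 * b + + 1 * a + + 1 * b ≡ a + b
  im-eq = solve-∀-ℤ

0≤-* : ∀ {i j} → 0ℤ ≤ i → 0ℤ ≤ j → 0ℤ ≤ i * j
0≤-* (+≤+ {n = m} _) (+≤+ {n = n} _) = subst (0ℤ ≤_) (ℤ.pos-* m n) (+≤+ z≤n)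

0<-* : ∀ {i j} → 0ℤ < i → 0ℤ < j → 0ℤ < i * j
0<-* (+<+ {n = suc m} _) (+<+ {n = suc n} _) = +<+ (s≤s z≤n)

0≤2* : ∀ {i} → 0ℤ ≤ i → 0ℤ ≤ + 2 * i
0≤2* = 0≤-* {+ 2} (+≤+ z≤n)

0≤-square : ∀ i → 0ℤ ≤ i * i
0≤-square (+ n)      = subst (0ℤ ≤_) (ℤ.pos-* n n) (+≤+ z≤n)
0≤-square (-[1+ n ]) = subst (0ℤ ≤_) (ℤ.pos-* (suc n) (suc n)) (+≤+ z≤n)

0<j-i⇒i<j : ∀ {i j} → 0ℤ < j - i → i < j
0<j-i⇒i<j {i} {j} 0<j-i = subst₂ _<_ (ℤ.+-identityʳ i) (i+[j-i]≡j i j) (ℤ.+-monoʳ-< i 0<j-i)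
  where
  i+[j-i]≡j : ∀ i j → i + (j - i) ≡ j
  i+[j-i]≡j = solve-∀-ℤ

trace : ℤφ → ℤ
trace (mk a b) = + 2 * a + b

norm : ℤφ → ℤ
norm (mk a b) = a * a + a * b - b * b

-- x > 0 as a real number.  Here trace x = x + x̄, norm x = x x̄ and x − x̄ = b√5, so for b ≥ 0 the
-- larger conjugate is x, while for b ≤ 0 both conjugates must be positive.
Positive : ℤφ → Set
Positive x = (0ℤ ≤ im x × (0ℤ < trace x ⊎ norm x < 0ℤ))
           ⊎ (im x ≤ 0ℤ × 0ℤ < trace x × 0ℤ < norm x)

-- (2a + b)² − 5b² = 4 · norm (mk a b)
Positive⇒Sqrt5Lt : ∀ x → Positive x → Sqrt5Lt (- im x) (trace x)
Positive⇒Sqrt5Lt (mk a b) (inj₁ (0≤b , inj₁ 0<T)) = inj₁ (ℤ.neg-mono-≤ 0≤b , inj₁ 0<T)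
Positive⇒Sqrt5Lt (mk a b) (inj₁ (0≤b , inj₂ N<0)) =
  inj₁ (ℤ.neg-mono-≤ 0≤b ,
        inj₂ (0<j-i⇒i<j (subst (0ℤ <_) (sym (gap a b)) (0<-* {+ 4} (+<+ (s≤s z≤n)) (ℤ.neg-mono-< N<0)))))
  where
  gap : ∀ a b → + 5 * (- b * - b) - (+ 2 * a + b) * (+ 2 * a + b) ≡ + 4 * - (a * a + a * b - b * b)
  gap = solve-∀-ℤ
Positive⇒Sqrt5Lt (mk a b) (inj₂ (b≤0 , 0<T , 0<N)) =
  inj₂ (ℤ.neg-mono-≤ b≤0 , 0<T ,
        0<j-i⇒i<j (subst (0ℤ <_) (sym (gap a b)) (0<-* {+ 4} (+<+ (s≤s z≤n)) 0<N)))
  where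
  gap : ∀ a b → (+ 2 * a + b) * (+ 2 * a + b) - + 5 * (- b * - b) ≡ + 4 * (a * a + a * b - b * b)
  gap = solve-∀-ℤ

norm-α⁻¹*φ-mk : ∀ a b → norm (mk (b - a) a) ≡ - norm (mk a b)
norm-α⁻¹*φ-mk = expanded
  where
  expanded : ∀ a b → (b - a) * (b - a) + (b - a) * a - a * a ≡ - (a * a + a * b - b * b)
  expanded = solve-∀-ℤ

im≤0∧trace>0⇒re≥0 : ∀ a b → b ≤ 0ℤ → 0ℤ < trace (mk a b) → 0ℤ ≤ a
im≤0∧trace>0⇒re≥0 a b b≤0 0<T = ℤ.<⇒≤ (ℤ.*-cancelˡ-<-nonNeg (+ 2) 0<2a)
  where
  certificate : ∀ a b → + 2 * a ≡ (+ 2 * a + b) + - b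
  certificate = solve-∀-ℤ
  0<2a : + 2 * 0ℤ < + 2 * a
  0<2a = subst (0ℤ <_) (sym (certificate a b)) (ℤ.+-mono-<-≤ 0<T (ℤ.neg-mono-≤ b≤0))

re<0∧trace>0⇒norm<0 : ∀ a b → a < 0ℤ → 0ℤ < trace (mk a b) → norm (mk a b) < 0ℤ
re<0∧trace>0⇒norm<0 a b a<0 0<T = ℤ.neg-cancel-< (subst (0ℤ <_) (sym (certificate a b)) 0<rhs)
  where
  certificate : ∀ a b → - (a * a + a * b - b * b) ≡ - a * ((+ 2 * a + b) + - a) + b * b
  certificate = solve-∀-ℤ
  0<rhs : 0ℤ < - a * ((+ 2 * a + b) + - a) + b * b
  0<rhs = ℤ.+-mono-<-≤
    (0<-* (ℤ.neg-mono-< a<0) (ℤ.+-mono-<-≤ 0<T (ℤ.<⇒≤ (ℤ.neg-mono-< a<0)))) (0≤-square b)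

im≥0∧re<0⇒trace′>0 : ∀ a b → 0ℤ ≤ b → a < 0ℤ → 0ℤ < trace (mk (b - a) a)
im≥0∧re<0⇒trace′>0 a b 0≤b a<0 =
  subst (0ℤ <_) (sym (certificate a b)) (ℤ.+-mono-<-≤ (ℤ.neg-mono-< a<0) (0≤2* 0≤b))
  where
  certificate : ∀ a b → + 2 * (b - a) + a ≡ - a + + 2 * b
  certificate = solve-∀-ℤ

im≥0∧trace′≤0⇒norm≥0 : ∀ a b → 0ℤ ≤ b → trace (mk (b - a) a) ≤ 0ℤ → 0ℤ ≤ norm (mk a b)
im≥0∧trace′≤0⇒norm≥0 a b 0≤b T′≤0 = subst (0ℤ ≤_) (sym (certificate a b))
  (ℤ.+-mono-≤ (0≤-square a) (0≤-* 0≤b (ℤ.+-mono-≤ (ℤ.neg-mono-≤ T′≤0) 0≤b)))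
  where
  certificate : ∀ a b → a * a + a * b - b * b ≡ a * a + b * (- (+ 2 * (b - a) + a) + b)
  certificate = solve-∀-ℤ

trace′≤0∧trace>0⇒norm>0 : ∀ a b → 0ℤ ≤ a → 0ℤ ≤ b →
  trace (mk (b - a) a) ≤ 0ℤ → 0ℤ < trace (mk a b) → 0ℤ < norm (mk a b)
trace′≤0∧trace>0⇒norm>0 a b 0≤a 0≤b T′≤0 0<T = ℤ.*-cancelˡ-<-nonNeg (+ 5) 0<5N
  where
  certificate : ∀ a b → + 5 * (a * a + a * b - b * b)
              ≡ (+ 2 * a + b) * (+ 2 * a + b) + - (+ 2 * (b - a) + a) * (a + + 3 * b)
  certificate = solve-∀-ℤ
  0<5N : + 5 * 0ℤ < + 5 * norm (mk a b)
  0<5N = subst (0ℤ <_) (sym (certificate a b)) (ℤ.+-mono-<-≤ (0<-* 0<T 0<T)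
    (0≤-* (ℤ.neg-mono-≤ T′≤0) (ℤ.+-mono-≤ 0≤a (0≤-* {+ 3} (+≤+ z≤n) 0≤b))))

-- α⁻¹ has norm −1, so multiplying by it flips the sign of the norm; the case split on the
-- signs of a and of the new trace 2b − a picks the clause of Positive that holds afterwards.
Positive-α⁻¹*φ : ∀ x → Positive x → Positive (α⁻¹ *φ x)
Positive-α⁻¹*φ (mk a b) p = subst Positive (sym (α⁻¹*φ-mk a b)) (shift p)
  where
  0<N′ : norm (mk a b) < 0ℤ → 0ℤ < norm (mk (b - a) a)
  0<N′ N<0 = subst (0ℤ <_) (sym (norm-α⁻¹*φ-mk a b)) (ℤ.neg-mono-< N<0)
  N′<0 : 0ℤ < norm (mk a b) → norm (mk (b - a) a) < 0ℤ
  N′<0 0<N = subst (_< 0ℤ) (sym (norm-α⁻¹*φ-mk a b)) (ℤ.neg-mono-< 0<N)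
  shift : Positive (mk a b) → Positive (mk (b - a) a)
  shift (inj₂ (b≤0 , 0<T , 0<N)) = inj₁ (im≤0∧trace>0⇒re≥0 a b b≤0 0<T , inj₂ (N′<0 0<N))
  shift (inj₁ (0≤b , inj₁ 0<T)) with a ℤ.<? 0ℤ | 0ℤ ℤ.<? trace (mk (b - a) a)
  ... | yes a<0 | _        =
    inj₂ (ℤ.<⇒≤ a<0 , im≥0∧re<0⇒trace′>0 a b 0≤b a<0 , 0<N′ (re<0∧trace>0⇒norm<0 a b a<0 0<T))
  ... | no a≮0  | yes 0<T′ = inj₁ (ℤ.≮⇒≥ a≮0 , inj₁ 0<T′)
  ... | no a≮0  | no T′≯0  =
    inj₁ (ℤ.≮⇒≥ a≮0 , inj₂ (N′<0 (trace′≤0∧trace>0⇒norm>0 a b (ℤ.≮⇒≥ a≮0) 0≤b (ℤ.≮⇒≥ T′≯0) 0<T)))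
  shift (inj₁ (0≤b , inj₂ N<0)) with a ℤ.<? 0ℤ | 0ℤ ℤ.<? trace (mk (b - a) a)
  ... | yes a<0 | _        = inj₂ (ℤ.<⇒≤ a<0 , im≥0∧re<0⇒trace′>0 a b 0≤b a<0 , 0<N′ N<0)
  ... | no a≮0  | yes 0<T′ = inj₁ (ℤ.≮⇒≥ a≮0 , inj₁ 0<T′)
  ... | no _    | no T′≯0  =
    contradiction (im≥0∧trace′≤0⇒norm≥0 a b 0≤b (ℤ.≮⇒≥ T′≯0)) (ℤ.<⇒≱ N<0)

NonNegCoords : ℤφ → Set
NonNegCoords (mk a b) = 0ℤ ≤ a × 0ℤ ≤ b

PositiveCoords : ℤφ → Set
PositiveCoords (mk a b) = (0ℤ ≤ a × 0ℤ ≤ b) × (0ℤ < a ⊎ 0ℤ < b)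

NonNegCoords-φ*φ : ∀ {x} → NonNegCoords x → NonNegCoords (φ *φ x)
NonNegCoords-φ*φ {mk a b} (0≤a , 0≤b) =
  subst NonNegCoords (sym (φ*φ-mk a b)) (0≤b , ℤ.+-mono-≤ 0≤a 0≤b)

PositiveCoords-φ*φ : ∀ {x} → PositiveCoords x → PositiveCoords (φ *φ x)
PositiveCoords-φ*φ {mk a b} ((0≤a , 0≤b) , 0<a⊎0<b) =
  subst PositiveCoords (sym (φ*φ-mk a b))
    ((0≤b , ℤ.+-mono-≤ 0≤a 0≤b) , [ (λ 0<a → inj₂ (ℤ.+-mono-<-≤ 0<a 0≤b)) , inj₁ ]′ 0<a⊎0<b)

NonNegCoords-+φ : ∀ {x y} → NonNegCoords x → NonNegCoords y → NonNegCoords (x +φ y)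
NonNegCoords-+φ {mk a b} {mk c d} (0≤a , 0≤b) (0≤c , 0≤d) = ℤ.+-mono-≤ 0≤a 0≤c , ℤ.+-mono-≤ 0≤b 0≤d

PositiveCoords-+φ : ∀ {x y} → PositiveCoords x → NonNegCoords y → PositiveCoords (x +φ y)
PositiveCoords-+φ {mk a b} {mk c d} ((0≤a , 0≤b) , 0<a⊎0<b) (0≤c , 0≤d) =
  (ℤ.+-mono-≤ 0≤a 0≤c , ℤ.+-mono-≤ 0≤b 0≤d) ,
  map (λ 0<a → ℤ.+-mono-<-≤ 0<a 0≤c) (λ 0<b → ℤ.+-mono-<-≤ 0<b 0≤d) 0<a⊎0<b

data Cone (B : ℤφ → Set) : ℤφ → Set where
  base   : ∀ {x} → B x → Cone B x
  shrink : ∀ {x} → Cone B x → Cone B (α⁻¹ *φ x)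

Cone-φ*φ : ∀ {B} → (∀ {x} → B x → B (φ *φ x)) → ∀ {x} → Cone B x → Cone B (φ *φ x)
Cone-φ*φ B-φ (base b) = base (B-φ b)
Cone-φ*φ {B} B-φ (shrink {x} c) = subst (Cone B) (sym (φ*α⁻¹*φ x)) c
  where
  φ*α⁻¹*φ : ∀ x → φ *φ (α⁻¹ *φ x) ≡ x
  φ*α⁻¹*φ = solve-∀ ℤφ-ring

-- The summand with fewer factors α⁻¹ is multiplied by φ = (α⁻¹)⁻¹ until both have the same.
module _ {B C D : ℤφ → Set}
         (B-φ : ∀ {x} → B x → B (φ *φ x)) (C-φ : ∀ {x} → C x → C (φ *φ x))
         (B+C : ∀ {x y} → B x → C y → D (x +φ y)) where

  base-+φ-Cone : ∀ {x y} → B x → Cone C y → Cone D (x +φ y)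
  base-+φ-Cone b (base c) = base (B+C b c)
  base-+φ-Cone {x} b (shrink {y} c) =
    subst (Cone D) (α⁻¹-out x y) (shrink (base-+φ-Cone (B-φ b) c))
    where
    α⁻¹-out : ∀ x y → α⁻¹ *φ ((φ *φ x) +φ y) ≡ x +φ (α⁻¹ *φ y)
    α⁻¹-out = solve-∀ ℤφ-ring

  Cone-+φ : ∀ {x y} → Cone B x → Cone C y → Cone D (x +φ y)
  Cone-+φ (base b) c = base-+φ-Cone b c
  Cone-+φ {y = y} (shrink {x} b) c =
    subst (Cone D) (α⁻¹-out x y) (shrink (Cone-+φ b (Cone-φ*φ C-φ c)))
    where
    α⁻¹-out : ∀ x y → α⁻¹ *φ (x +φ (φ *φ y)) ≡ (α⁻¹ *φ x) +φ y
    α⁻¹-out = solve-∀ ℤφ-ring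

NonNeg : ℤφ → Set
NonNeg = Cone NonNegCoords

StrictPos : ℤφ → Set
StrictPos = Cone PositiveCoords

NonNeg-+φ : ∀ {x y} → NonNeg x → NonNeg y → NonNeg (x +φ y)
NonNeg-+φ = Cone-+φ NonNegCoords-φ*φ NonNegCoords-φ*φ NonNegCoords-+φ

StrictPos-+φ : ∀ {x y} → StrictPos x → NonNeg y → StrictPos (x +φ y)
StrictPos-+φ = Cone-+φ PositiveCoords-φ*φ NonNegCoords-φ*φ PositiveCoords-+φ

NonNeg-α⁻¹^ : ∀ n → NonNeg (α⁻¹ ^φ n)
NonNeg-α⁻¹^ zero    = base (+≤+ z≤n , +≤+ z≤n)
NonNeg-α⁻¹^ (suc n) = shrink (NonNeg-α⁻¹^ n)

StrictPos⇒Positive : ∀ {x} → StrictPos x → Positive x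
StrictPos⇒Positive {mk a b} (base ((0≤a , 0≤b) , inj₁ 0<a)) =
  inj₁ (0≤b , inj₁ (ℤ.+-mono-<-≤ (0<-* {+ 2} (+<+ (s≤s z≤n)) 0<a) 0≤b))
StrictPos⇒Positive {mk a b} (base ((0≤a , 0≤b) , inj₂ 0<b)) =
  inj₁ (0≤b , inj₁ (ℤ.+-mono-≤-< (0≤2* 0≤a) 0<b))
StrictPos⇒Positive (shrink {x} c) = Positive-α⁻¹*φ x (StrictPos⇒Positive c)

-- A record rather than a definition, so that x and y can be inferred from a proof.
record _≤φ_ (x y : ℤφ) : Set where
  constructor nonneg-gap
  field gap : NonNeg (y -φ x)

∣_∣≤_ : ℤφ → ℤφ → Set
∣ x ∣≤ y = x ≤φ y × -φ x ≤φ y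

≤φ-refl : ∀ x → x ≤φ x
≤φ-refl x = nonneg-gap (subst NonNeg (sym (x-x≡0 x)) (base (+≤+ z≤n , +≤+ z≤n)))
  where
  x-x≡0 : ∀ x → x -φ x ≡ 0φ
  x-x≡0 = solve-∀ ℤφ-ring

≤φ-trans : ∀ {x y z} → x ≤φ y → y ≤φ z → x ≤φ z
≤φ-trans {x} {y} {z} (nonneg-gap x≤y) (nonneg-gap y≤z) =
  nonneg-gap (subst NonNeg (telescope x y z) (NonNeg-+φ x≤y y≤z))
  where
  telescope : ∀ x y z → (y -φ x) +φ (z -φ y) ≡ z -φ x
  telescope = solve-∀ ℤφ-ring

∣0∣≤0 : ∣ 0φ ∣≤ 0φ
∣0∣≤0 = nonneg-gap (base (+≤+ z≤n , +≤+ z≤n)) , nonneg-gap (base (+≤+ z≤n , +≤+ z≤n))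

∣∣≤-weaken : ∀ {x u v} → ∣ x ∣≤ u → u ≤φ v → ∣ x ∣≤ v
∣∣≤-weaken (x≤u , -x≤u) u≤v = ≤φ-trans x≤u u≤v , ≤φ-trans -x≤u u≤v

∣∣≤-+φ : ∀ {x y u v} → ∣ x ∣≤ u → ∣ y ∣≤ v → ∣ x +φ y ∣≤ (u +φ v)
∣∣≤-+φ {x} {y} {u} {v} (nonneg-gap x≤u , nonneg-gap -x≤u) (nonneg-gap y≤v , nonneg-gap -y≤v) =
  nonneg-gap (subst NonNeg (sum-of-gaps x y u v) (NonNeg-+φ x≤u y≤v)) ,
  nonneg-gap (subst NonNeg (sum-of-gaps′ x y u v) (NonNeg-+φ -x≤u -y≤v))
  where
  sum-of-gaps : ∀ x y u v → (u -φ x) +φ (v -φ y) ≡ (u +φ v) -φ (x +φ y)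
  sum-of-gaps = solve-∀ ℤφ-ring
  sum-of-gaps′ : ∀ x y u v → (u -φ -φ x) +φ (v -φ -φ y) ≡ (u +φ v) -φ -φ (x +φ y)
  sum-of-gaps′ = solve-∀ ℤφ-ring

∣∣≤-neg : ∀ {x y} → ∣ x ∣≤ y → ∣ -φ x ∣≤ y
∣∣≤-neg {x} {y} (x≤y , -x≤y) = -x≤y , subst (_≤φ y) (sym (-φ-involutive x)) x≤y
  where
  -φ-involutive : ∀ x → -φ -φ x ≡ x
  -φ-involutive = solve-∀ ℤφ-ring

∣∣≤-α⁻¹*φ : ∀ {x y} → ∣ x ∣≤ y → ∣ α⁻¹ *φ x ∣≤ α⁻¹ *φ y
∣∣≤-α⁻¹*φ {x} {y} (nonneg-gap x≤y , nonneg-gap -x≤y) =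
  nonneg-gap (subst NonNeg (α⁻¹-in x y) (shrink x≤y)) ,
  nonneg-gap (subst NonNeg (α⁻¹-in′ x y) (shrink -x≤y))
  where
  α⁻¹-in : ∀ x y → α⁻¹ *φ (y -φ x) ≡ (α⁻¹ *φ y) -φ (α⁻¹ *φ x)
  α⁻¹-in = solve-∀ ℤφ-ring
  α⁻¹-in′ : ∀ x y → α⁻¹ *φ (y -φ -φ x) ≡ (α⁻¹ *φ y) -φ -φ (α⁻¹ *φ x)
  α⁻¹-in′ = solve-∀ ℤφ-ring

∣∣≤-β*φ : ∀ {x y} → ∣ x ∣≤ y → ∣ β *φ x ∣≤ α⁻¹ *φ y
∣∣≤-β*φ {x} x≤y = subst (∣_∣≤ _) (sym (β≡-α⁻¹ x)) (∣∣≤-neg (∣∣≤-α⁻¹*φ x≤y))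
  where
  β≡-α⁻¹ : ∀ x → β *φ x ≡ -φ (α⁻¹ *φ x)
  β≡-α⁻¹ = solve-∀ ℤφ-ring

∣^∣≤α⁻¹^ : ∀ {x} → (∀ {z y} → ∣ z ∣≤ y → ∣ x *φ z ∣≤ α⁻¹ *φ y) → ∀ n → ∣ x ^φ n ∣≤ α⁻¹ ^φ n
∣^∣≤α⁻¹^ x*-bound zero    = nonneg-gap (base (+≤+ z≤n , +≤+ z≤n)) , nonneg-gap (base (+≤+ z≤n , +≤+ z≤n))
∣^∣≤α⁻¹^ x*-bound (suc n) = x*-bound (∣^∣≤α⁻¹^ x*-bound n)

geometric : ℕ → ℤφ
geometric zero    = 0φ
geometric (suc n) = (α⁻¹ ^φ n) +φ geometric n

geometric-closed : ∀ n → geometric n ≡ φ² -φ (φ² *φ (α⁻¹ ^φ n))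
geometric-closed zero    = refl
geometric-closed (suc n) = trans (cong ((α⁻¹ ^φ n) +φ_) (geometric-closed n)) (step (α⁻¹ ^φ n))
  where
  step : ∀ y → y +φ (φ² -φ (φ² *φ y)) ≡ φ² -φ (φ² *φ (α⁻¹ *φ y))
  step = solve-∀ ℤφ-ring

geometric-≤φ-suc : ∀ n → geometric n ≤φ geometric (suc n)
geometric-≤φ-suc n =
  nonneg-gap (subst NonNeg (sym (cancel (α⁻¹ ^φ n) (geometric n))) (NonNeg-α⁻¹^ n))
  where
  cancel : ∀ y g → (y +φ g) -φ g ≡ y
  cancel = solve-∀ ℤφ-ring

geometric-mono : ∀ {m n} → m ≤′ n → geometric m ≤φ geometric n
geometric-mono (≤′-reflexive refl) = ≤φ-refl _
geometric-mono (≤′-step {n} m≤n)   = ≤φ-trans (geometric-mono m≤n) (geometric-≤φ-suc n)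

∣sumPows∣≤geometric : ∀ {x} → (∀ n → ∣ x ^φ n ∣≤ α⁻¹ ^φ n) →
                      ∀ {m ns} → Linked _>_ (m ∷ ns) → ∣ sumPows x ns ∣≤ geometric m
∣sumPows∣≤geometric pow-bound {ns = []} [-] = ∣∣≤-weaken ∣0∣≤0 (geometric-mono (≤⇒≤′ z≤n))
∣sumPows∣≤geometric pow-bound {ns = n ∷ ns} (n<m ∷ sorted) =
  ∣∣≤-weaken (∣∣≤-+φ (pow-bound n) (∣sumPows∣≤geometric pow-bound sorted)) (geometric-mono (≤⇒≤′ n<m))

-- 3 = α⁻² + φ² and φ² − geometric m = φ²α⁻ᵐ.
s≤geometric⇒StrictPos[3-s] : ∀ m {s} → s ≤φ geometric m → StrictPos (three -φ s)
s≤geometric⇒StrictPos[3-s] m {s} (nonneg-gap s≤G) =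
  subst StrictPos (sym (three-split m s)) (StrictPos-+φ α⁻²>0 (NonNeg-+φ φ²α⁻ᵐ≥0 s≤G))
  where
  α⁻²>0 : StrictPos (α⁻¹ *φ α⁻¹)
  α⁻²>0 = shrink {x = α⁻¹} (shrink {x = 1φ} (base ((+≤+ z≤n , +≤+ z≤n) , inj₁ (+<+ (s≤s z≤n)))))
  φ²α⁻ᵐ≥0 : NonNeg (φ *φ (φ *φ (α⁻¹ ^φ m)))
  φ²α⁻ᵐ≥0 = Cone-φ*φ NonNegCoords-φ*φ (Cone-φ*φ NonNegCoords-φ*φ (NonNeg-α⁻¹^ m))
  split : ∀ y s → three -φ s ≡ (α⁻¹ *φ α⁻¹) +φ ((φ *φ (φ *φ y)) +φ ((φ² -φ (φ² *φ y)) -φ s))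
  split = solve-∀ ℤφ-ring
  three-split : ∀ m s →
    three -φ s ≡ (α⁻¹ *φ α⁻¹) +φ ((φ *φ (φ *φ (α⁻¹ ^φ m))) +φ (geometric m -φ s))
  three-split m s = trans (split (α⁻¹ ^φ m) s)
    (cong (λ g → (α⁻¹ *φ α⁻¹) +φ ((φ *φ (φ *φ (α⁻¹ ^φ m))) +φ (g -φ s))) (sym (geometric-closed m)))

Positive[3∓s]⇒AbsLt3 : ∀ s → Positive (three -φ s) → Positive (three -φ -φ s) → AbsLt3 s
Positive[3∓s]⇒AbsLt3 (mk a b) 3-s>0 3+s>0 =
  subst₂ Sqrt5Lt (e₁ a b) (e₂ a b) (Positive⇒Sqrt5Lt (three -φ mk a b) 3-s>0) ,
  subst₂ Sqrt5Lt (e₃ a b) (e₄ a b) (Positive⇒Sqrt5Lt (three -φ -φ mk a b) 3+s>0)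
  where
  e₁ : ∀ a b → - (+ 0 + - b) ≡ b
  e₁ = solve-∀-ℤ
  e₂ : ∀ a b → + 2 * (+ 3 + - a) + (+ 0 + - b) ≡ + 6 + - (+ 2 * a + b)
  e₂ = solve-∀-ℤ
  e₃ : ∀ a b → - (+ 0 + - - b) ≡ - b
  e₃ = solve-∀-ℤ
  e₄ : ∀ a b → + 2 * (+ 3 + - - a) + (+ 0 + - - b) ≡ + 6 + (+ 2 * a + b)
  e₄ = solve-∀-ℤ

∣∣≤geometric⇒AbsLt3 : ∀ m {s} → ∣ s ∣≤ geometric m → AbsLt3 s
∣∣≤geometric⇒AbsLt3 m {s} (s≤G , -s≤G) =
  Positive[3∓s]⇒AbsLt3 s (StrictPos⇒Positive (s≤geometric⇒StrictPos[3-s] m s≤G))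
                         (StrictPos⇒Positive (s≤geometric⇒StrictPos[3-s] m -s≤G))

lemma2p3 : (ns : List ℕ) → ns ≢ [] → Linked _>_ ns →
           AbsLt3 (sumPows α⁻¹ ns) × AbsLt3 (sumPows β ns)
lemma2p3 []       ns≢[] _      = ⊥-elim (ns≢[] refl)
lemma2p3 (n ∷ ns) _     sorted =
  ∣∣≤geometric⇒AbsLt3 (suc n) (∣sumPows∣≤geometric (∣^∣≤α⁻¹^ ∣∣≤-α⁻¹*φ) (n<1+n n ∷ sorted)) ,
  ∣∣≤geometric⇒AbsLt3 (suc n) (∣sumPows∣≤geometric (∣^∣≤α⁻¹^ ∣∣≤-β*φ) (n<1+n n ∷ sorted))
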